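{- Let $n\ge1$ and $0\le d\le n$ be integers, and let $S$ be a maximum weight de Bruijn sequence of order $n$ and maximum weight $d$. Then the number of $0$s in $S$ exceeds the number of $1$s in $S$ by exactly $\binom{n-1}{d}$.
   Context: The weight of a binary string is its number of $1$s. A maximum weight de Bruijn sequence of order $n$ and maximum weight $d$ is a circular binary string that contains each binary string of length $n$ with weight at most $d$ exactly once as a circular substring, and contains no other length-$n$ circular substrings (so its length is $\sum_{j=0}^{d}\binom{n}{j}$). -}

module Defs where

open import Data.Bool using (Bool; true; false; if_then_else_)
open import Data.Nat using (ℕ; zero; suc; _+_; _≤_; _≤ᵇ_; _%_)
open import Data.List using (List; []; _∷_; length; map; filter; _++_; upTo; lookup)
open import Data.Vec using (Vec; []; _∷_; tabulate)
import Data.Vec as Vec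
open import Data.Fin using (Fin; fromℕ<)
open import Data.Nat.DivMod using (m%n<n)
open import Relation.Nullary using (¬_)
open import Relation.Binary.PropositionalEquality using (_≡_)
open import Data.List.Relation.Binary.Permutation.Propositional using (_↭_)

weightV : ∀ {n} → Vec Bool n → ℕ
weightV [] = 0
weightV (true ∷ v) = suc (weightV v)
weightV (false ∷ v) = weightV v

ones : List Bool → ℕ
ones [] = 0
ones (true ∷ s) = suc (ones s)
ones (false ∷ s) = ones s

zeros : List Bool → ℕ
zeros [] = 0
zeros (true ∷ s) = zeros s
zeros (false ∷ s) = suc (zeros s)

allStrings : (n : ℕ) → List (Vec Bool n)
allStrings zero = [] ∷ []
allStrings (suc n) = map (false ∷_) (allStrings n) ++ map (true ∷_) (allStrings n)

atC : (b : Bool) (S : List Bool) → ℕ → Bool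
atC b S k = lookup (b ∷ S) (fromℕ< (m%n<n k (suc (length S))))

cyc : List Bool → ℕ → Bool
cyc [] k = false   -- never used: windows of the empty string are none
cyc (b ∷ S) k = atC b S k

window : (n : ℕ) → List Bool → ℕ → Vec Bool n
window n S i = tabulate (λ j → cyc S (i + Data.Fin.toℕ j))

windows : (n : ℕ) → List Bool → List (Vec Bool n)
windows n S = map (window n S) (upTo (length S))

boundedStrings : (n d : ℕ) → List (Vec Bool n)
boundedStrings n d = filter (λ v → weightV v Data.Nat.≤? d) (allStrings n)

-- S is a maximum weight de Bruijn sequence of order n and max weight d:
-- its circular length-n substrings are exactly the strings of weight ≤ d,
-- each occurring exactly once (as a multiset equality).
IsMaxWeightDB : (n d : ℕ) → List Bool → Set
IsMaxWeightDB n d S = windows n S ↭ boundedStrings n d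

module Submission where

-- Read the circular string S through its windows of
-- length n = m + 1: the first symbols of the |S| windows, taken in order,
-- spell S itself.  Since the windows of a de Bruijn sequence are a
-- permutation of the strings of weight ≤ d, the symbol counts of S equal
-- the symbol counts of the first symbols of those strings.  A string of
-- length m + 1 and weight ≤ d is either 0v with wt v ≤ d or 1v with
-- wt v < d, so S has  A(m,d) = #{v ∈ 2^m | wt v ≤ d}  zeros and
-- B(m,d) = #{v ∈ 2^m | wt v < d}  ones.  Finally A(m,d) = B(m,d) + C(m,d),
-- proved by induction on m from Pascal's rule.

open import Defs
open import Data.Bool using (Bool; true; false; not)
open import Data.List using (List; []; _∷_; length; map; filter; _++_; upTo; applyUpTo; lookup; tabulate; replicate)
open import Data.List.Properties
  using (map-∘; map-cong; map-upTo; map-++; tabulate-cong; tabulate-lookup;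
         length-map; length-++; filter-++; filter-≐; filter-none)
open import Data.List.Relation.Binary.Permutation.Propositional using (_↭_; refl; prep; swap; trans)
open import Data.List.Relation.Binary.Permutation.Propositional.Properties using (map⁺)
import Data.List.Relation.Unary.All as All
open import Data.Vec using (Vec; _∷_; head)
open import Data.Nat using (ℕ; zero; suc; _≤_; _+_; _∸_; s≤s; s≤s⁻¹; _%_)
open import Data.Nat.Properties using (_≤?_; _<?_; n≮0; +-identityʳ; +-comm; +-commutativeSemigroup)
open import Data.Nat.DivMod using (m%n<n; m<n⇒m%n≡m)
open import Data.Nat.Combinatorics using (_C_; nCk+nC[k+1]≡[n+1]C[k+1])
open import Data.Fin using (Fin; toℕ; fromℕ<)
open import Data.Fin.Properties using (toℕ-injective; toℕ-fromℕ<; toℕ<n)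
open import Data.Product using (_,_)
open import Function using (_∘_)
open import Relation.Nullary using (does)
open import Relation.Unary using (Decidable)
open import Algebra.Properties.CommutativeSemigroup +-commutativeSemigroup using (interchange)
open import Relation.Binary.PropositionalEquality using (_≡_; refl; sym; cong; cong₂; subst₂; module ≡-Reasoning)
  renaming (trans to ≡-trans)
open ≡-Reasoning

ones-↭ : {xs ys : List Bool} → xs ↭ ys → ones xs ≡ ones ys
ones-↭ refl = refl
ones-↭ (prep true p) = cong suc (ones-↭ p)
ones-↭ (prep false p) = ones-↭ p
ones-↭ (swap true true p) = cong (suc ∘ suc) (ones-↭ p)
ones-↭ (swap true false p) = cong suc (ones-↭ p)
ones-↭ (swap false true p) = cong suc (ones-↭ p)
ones-↭ (swap false false p) = ones-↭ p
ones-↭ (trans p q) = ≡-trans (ones-↭ p) (ones-↭ q)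

zeros≡ones∘not : (xs : List Bool) → zeros xs ≡ ones (map not xs)
zeros≡ones∘not [] = refl
zeros≡ones∘not (true ∷ xs) = zeros≡ones∘not xs
zeros≡ones∘not (false ∷ xs) = cong suc (zeros≡ones∘not xs)

zeros-↭ : {xs ys : List Bool} → xs ↭ ys → zeros xs ≡ zeros ys
zeros-↭ {xs} {ys} p = begin
  zeros xs             ≡⟨ zeros≡ones∘not xs ⟩
  ones (map not xs)    ≡⟨ ones-↭ (map⁺ not p) ⟩
  ones (map not ys)    ≡⟨ sym (zeros≡ones∘not ys) ⟩
  zeros ys             ∎

zeros-block : (a b : ℕ) → zeros (replicate a false ++ replicate b true) ≡ a
zeros-block (suc a) b = cong suc (zeros-block a b)
zeros-block zero zero = refl
zeros-block zero (suc b) = zeros-block zero b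

ones-block : (a b : ℕ) → ones (replicate a false ++ replicate b true) ≡ b
ones-block (suc a) b = ones-block a b
ones-block zero zero = refl
ones-block zero (suc b) = cong suc (ones-block zero b)

cyc-lookup : (S : List Bool) (i : Fin (length S)) → cyc S (toℕ i) ≡ lookup S i
cyc-lookup S@(b ∷ S′) i = cong (lookup S) (toℕ-injective (begin
  toℕ (fromℕ< (m%n<n (toℕ i) (length S)))  ≡⟨ toℕ-fromℕ< _ ⟩
  toℕ i % length S                         ≡⟨ m<n⇒m%n≡m (toℕ<n i) ⟩
  toℕ i                                    ∎))

applyUpTo-tabulate : {A : Set} (f : ℕ → A) (n : ℕ) → applyUpTo f n ≡ tabulate {n = n} (f ∘ toℕ)
applyUpTo-tabulate f zero = refl
applyUpTo-tabulate f (suc n) = cong (f 0 ∷_) (applyUpTo-tabulate (f ∘ suc) n)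

heads-of-windows : (m : ℕ) (S : List Bool) → map head (windows (suc m) S) ≡ S
heads-of-windows m S = begin
  map head (map (window (suc m) S) (upTo L))  ≡⟨ sym (map-∘ (upTo L)) ⟩
  map (λ i → cyc S (i + 0)) (upTo L)          ≡⟨ map-cong (cong (cyc S) ∘ +-identityʳ) (upTo L) ⟩
  map (cyc S) (upTo L)                        ≡⟨ map-upTo (cyc S) L ⟩
  applyUpTo (cyc S) L                         ≡⟨ applyUpTo-tabulate (cyc S) L ⟩
  tabulate (cyc S ∘ toℕ)                      ≡⟨ tabulate-cong (cyc-lookup S) ⟩
  tabulate (lookup S)                         ≡⟨ tabulate-lookup S ⟩
  S                                           ∎
  where
  L : ℕ
  L = length S

filter-map : {A B : Set} {P : B → Set} (P? : Decidable P) (f : A → B) (xs : List A) →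
             filter P? (map f xs) ≡ map f (filter (P? ∘ f) xs)
filter-map P? f [] = refl
filter-map P? f (x ∷ xs) with does (P? (f x))
... | true = cong (f x ∷_) (filter-map P? f xs)
... | false = filter-map P? f xs

lighterStrings : (m d : ℕ) → List (Vec Bool m)
lighterStrings m d = filter (λ v → weightV v <? d) (allStrings m)

boundedStrings-suc : (m d : ℕ) → boundedStrings (suc m) d ≡
  map (false ∷_) (boundedStrings m d) ++ map (true ∷_) (lighterStrings m d)
boundedStrings-suc m d = begin
  filter P? (map (false ∷_) A ++ map (true ∷_) A)              ≡⟨ filter-++ P? (map (false ∷_) A) _ ⟩
  filter P? (map (false ∷_) A) ++ filter P? (map (true ∷_) A)  ≡⟨ cong₂ _++_ (filter-map P? (false ∷_) A)
                                                                             (filter-map P? (true ∷_) A) ⟩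
  map (false ∷_) (boundedStrings m d) ++ map (true ∷_) (lighterStrings m d) ∎
  where
  A : List (Vec Bool m)
  A = allStrings m
  P? : Decidable (λ (v : Vec Bool (suc m)) → weightV v ≤ d)
  P? v = weightV v ≤? d

lighterStrings-zero : (m : ℕ) → lighterStrings m 0 ≡ []
lighterStrings-zero m = filter-none (λ v → weightV v <? 0) (All.universal (λ _ → n≮0) (allStrings m))

lighterStrings-suc : (m e : ℕ) → lighterStrings m (suc e) ≡ boundedStrings m e
lighterStrings-suc m e =
  filter-≐ (λ v → weightV v <? suc e) (λ v → weightV v ≤? e) (s≤s⁻¹ , s≤s) (allStrings m)

#bounded : ℕ → ℕ → ℕ
#bounded m d = length (boundedStrings m d)

#lighter : ℕ → ℕ → ℕ
#lighter m d = length (lighterStrings m d)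

#bounded-suc : (m d : ℕ) → #bounded (suc m) d ≡ #bounded m d + #lighter m d
#bounded-suc m d = begin
  length (boundedStrings (suc m) d)                    ≡⟨ cong length (boundedStrings-suc m d) ⟩
  length (map (false ∷_) B ++ map (true ∷_) L)         ≡⟨ length-++ (map (false ∷_) B) ⟩
  length (map (false ∷_) B) + length (map (true ∷_) L) ≡⟨ cong₂ _+_ (length-map (false ∷_) B) (length-map (true ∷_) L) ⟩
  #bounded m d + #lighter m d                          ∎
  where
  B L : List (Vec Bool m)
  B = boundedStrings m d
  L = lighterStrings m d

#lighter-zero : (m : ℕ) → #lighter m 0 ≡ 0
#lighter-zero m = cong length (lighterStrings-zero m)

#lighter-suc : (m e : ℕ) → #lighter m (suc e) ≡ #bounded m e
#lighter-suc m e = cong length (lighterStrings-suc m e)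

-- The strings of weight exactly d are counted by the binomial coefficient:
-- A(m,d) = B(m,d) + C(m,d).  Induction on m, using Pascal's rule.
#bounded≡#lighter+C : (m d : ℕ) → #bounded m d ≡ #lighter m d + m C d
#bounded≡#lighter+C zero zero = cong (_+ 1) (sym (#lighter-zero 0))
#bounded≡#lighter+C zero (suc e) = cong (_+ 0) (sym (#lighter-suc 0 e))
#bounded≡#lighter+C (suc m) zero = begin
  #bounded (suc m) 0              ≡⟨ #bounded-suc m 0 ⟩
  #bounded m 0 + #lighter m 0     ≡⟨ cong₂ _+_ (#bounded≡#lighter+C m 0) (#lighter-zero m) ⟩
  #lighter m 0 + 1 + 0            ≡⟨ cong (λ k → k + 1 + 0) (#lighter-zero m) ⟩
  1                               ≡⟨ cong (_+ 1) (sym (#lighter-zero (suc m))) ⟩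
  #lighter (suc m) 0 + 1          ∎
#bounded≡#lighter+C (suc m) (suc e) = begin
  #bounded (suc m) (suc e)                    ≡⟨ #bounded-suc m (suc e) ⟩
  #bounded m (suc e) + #lighter m (suc e)     ≡⟨ cong₂ _+_ (#bounded≡#lighter+C m (suc e)) (#lighter-suc m e) ⟩
  (#lighter m (suc e) + c′) + a               ≡⟨ cong (λ k → (k + c′) + a) (#lighter-suc m e) ⟩
  (a + c′) + a                                ≡⟨ cong ((a + c′) +_) (#bounded≡#lighter+C m e) ⟩
  (a + c′) + (b + c)                          ≡⟨ interchange a c′ b c ⟩
  (a + b) + (c′ + c)                          ≡⟨ cong₂ _+_ (sym (#bounded-suc m e)) (+-comm c′ c) ⟩
  #bounded (suc m) e + (c + c′)               ≡⟨ cong₂ _+_ (sym (#lighter-suc (suc m) e)) (nCk+nC[k+1]≡[n+1]C[k+1] m e) ⟩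
  #lighter (suc m) (suc e) + suc m C suc e    ∎
  where
  a b c c′ : ℕ
  a = #bounded m e
  b = #lighter m e
  c = m C e
  c′ = m C suc e

heads-of-prefixed : {m : ℕ} (b : Bool) (xs : List (Vec Bool m)) →
                    map head (map (b ∷_) xs) ≡ replicate (length xs) b
heads-of-prefixed b [] = refl
heads-of-prefixed b (x ∷ xs) = cong (b ∷_) (heads-of-prefixed b xs)

heads-of-bounded : (m d : ℕ) → map head (boundedStrings (suc m) d) ≡
                   replicate (#bounded m d) false ++ replicate (#lighter m d) true
heads-of-bounded m d = begin
  map head (boundedStrings (suc m) d)                          ≡⟨ cong (map head) (boundedStrings-suc m d) ⟩
  map head (map (false ∷_) B ++ map (true ∷_) L)               ≡⟨ map-++ head (map (false ∷_) B) _ ⟩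
  map head (map (false ∷_) B) ++ map head (map (true ∷_) L)    ≡⟨ cong₂ _++_ (heads-of-prefixed false B)
                                                                             (heads-of-prefixed true L) ⟩
  replicate (#bounded m d) false ++ replicate (#lighter m d) true ∎
  where
  B L : List (Vec Bool m)
  B = boundedStrings m d
  L = lighterStrings m d

maxWeightDB-symbols : (m d : ℕ) (S : List Bool) → IsMaxWeightDB (suc m) d S →
                      S ↭ replicate (#bounded m d) false ++ replicate (#lighter m d) true
maxWeightDB-symbols m d S db =
  subst₂ _↭_ (heads-of-windows m S) (heads-of-bounded m d) (map⁺ head db)

-- The theorem (with n = m + 1).
lemma4 : (n d : ℕ) → 1 ≤ n → d ≤ n → (S : List Bool) → IsMaxWeightDB n d S →
    zeros S ≡ ones S + ((n ∸ 1) C d)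
lemma4 (suc m) d _ _ S db = begin
  zeros S                                ≡⟨ zeros-↭ S↭block ⟩
  zeros block                            ≡⟨ zeros-block (#bounded m d) (#lighter m d) ⟩
  #bounded m d                           ≡⟨ #bounded≡#lighter+C m d ⟩
  #lighter m d + m C d                   ≡⟨ cong (_+ m C d) (sym (ones-block (#bounded m d) (#lighter m d))) ⟩
  ones block + m C d                     ≡⟨ cong (_+ m C d) (sym (ones-↭ S↭block)) ⟩
  ones S + m C d                         ∎
  where
  block : List Bool
  block = replicate (#bounded m d) false ++ replicate (#lighter m d) true
  S↭block : S ↭ block
  S↭block = maxWeightDB-symbols m d S db
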